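{- For every $k\in\mathbb{N}_0$ and every $a\in\{0,\dots,2^k-1\}$, writing $a=\sum_{i=1}^k\sigma_i2^{k-i}$ with $\sigma_i\in\{0,1\}$ and $\sigma=(\sigma_1,\dots,\sigma_k)$, we have $\hat h_k(a)=h_k(\sigma)$ and $\hat r_k(a)=r_k(\sigma)$.
   Context: For $k\in\mathbb{N}$ let $\mathbb{G}_k=(\mathbb{Z}/2\mathbb{Z})^k$, and for $\sigma\in\mathbb{G}_k$ let $1-\sigma:=(1-\sigma_1,\dots,1-\sigma_k)$. For $s_0,s_1\in\mathbb{R}$ define $\xi_k(s_0,s_1):\mathbb{G}_k\to\mathbb{R}$ by $\xi_1(s_0,s_1)(0)=s_0$, $\xi_1(s_0,s_1)(1)=s_1$, $\xi_{k+1}(s_0,s_1)(\sigma,\sigma_{k+1})=\xi_k(s_0,s_1)(\sigma)+\sigma_{k+1}\xi_k(s_0,s_1)(1-\sigma)$. For $k\in\mathbb{N}_0$ and $\sigma\in\mathbb{G}_k$ let $h_k(\sigma)=\xi_{k+1}(1,1)(0,\sigma)$ and $r_k(\sigma)=\xi_{k+1}(0,1)(0,\sigma)$. Define $\hat h_k,\hat r_k:\{0,\dots,2^k\}\to\mathbb{N}_0$ by $\hat h_0(0)=\hat h_0(1)=1$, $\hat r_0(0)=0$, $\hat r_0(1)=1$, $\hat h_{k+1}(2s)=\hat h_k(s)$, $\hat r_{k+1}(2s)=\hat r_k(s)$ for $s\in\{0,\dots,2^k\}$, and $\hat h_{k+1}(2s+1)=\hat h_k(s)+\hat h_k(s+1)$,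 $\hat r_{k+1}(2s+1)=\hat r_k(s)+\hat r_k(s+1)$ for $s\in\{0,\dots,2^k-1\}$. -}

module Defs where

open import Data.Nat using (ℕ; zero; suc; _+_; _*_; _^_)
open import Data.Nat.DivMod using (_/_; _%_)
open import Data.Fin using (Fin; toℕ) renaming (zero to f0; suc to fs)
open import Data.Vec using (Vec; []; _∷_; init; last; map; _∷ʳ_)

-- 𝔾_k = (ℤ/2ℤ)^k, σ = (σ_1, …, σ_k) with σ_1 the head of the vector
𝔾 : ℕ → Set
𝔾 k = Vec (Fin 2) k

flip2 : Fin 2 → Fin 2
flip2 f0 = fs f0
flip2 (fs _) = f0

1-_ : ∀ {k} → 𝔾 k → 𝔾 k
1- σ = map flip2 σ

-- ξ_k(s0,s1) : 𝔾_k → ℕ  (for k ≥ 1; index k here means ξ_{k+1})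
-- ξ_{1}(s0,s1)(0) = s0, ξ_1(s0,s1)(1) = s1,
-- ξ_{k+1}(s0,s1)(σ,σ_{k+1}) = ξ_k(σ) + σ_{k+1} ξ_k(1-σ)
ξ : ℕ → ℕ → (k : ℕ) → 𝔾 (suc k) → ℕ
ξ s0 s1 zero (f0 ∷ []) = s0
ξ s0 s1 zero (fs _ ∷ []) = s1
ξ s0 s1 (suc k) σ = ξ s0 s1 k (init σ) + toℕ (last σ) * ξ s0 s1 k (1- (init σ))

h : (k : ℕ) → 𝔾 k → ℕ
h k σ = ξ 1 1 k (f0 ∷ σ)

r : (k : ℕ) → 𝔾 k → ℕ
r k σ = ξ 0 1 k (f0 ∷ σ)

-- ĥ_k, r̂_k on {0,…,2^k} (values outside that range are irrelevant)
ĥ : ℕ → ℕ → ℕ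
ĥ zero n = 1
ĥ (suc k) n with n % 2
... | zero  = ĥ k (n / 2)
... | suc _ = ĥ k (n / 2) + ĥ k (suc (n / 2))

r̂ : ℕ → ℕ → ℕ
r̂ zero zero = 0
r̂ zero (suc _) = 1
r̂ (suc k) n with n % 2
... | zero  = r̂ k (n / 2)
... | suc _ = r̂ k (n / 2) + r̂ k (suc (n / 2))

value : ∀ {k} → 𝔾 k → ℕ
value {zero} [] = 0
value {suc k} (b ∷ σ) = toℕ b * 2 ^ k + value σ

module Submission where

-- Both ĥ and r̂ obey the Stern recurrence g_{k+1}(2m) = g_k(m), g_{k+1}(2m+1) = g_k(m) + g_k(m+1),
-- and differ only in their values at level 0.  The recursion for ξ peels off the last coordinate
-- of σ, which is the last binary digit of value σ, so ξ obeys the same recurrence.  The induction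
-- only closes if it also tracks the reflected point: ξ(1,τ) = g_k(value(1-τ) + 1) = g_k(2^k - value τ).

open import Defs
open import Data.Nat using (ℕ; zero; suc; _+_; _*_; _^_; _<_; _/_; _%_)
open import Data.Nat.Properties using (+-identityʳ; +-comm; *-identityʳ)
open import Data.Nat.DivMod using (m*n%n≡0; m*n/n≡m; [m+kn]%n≡m%n; +-distrib-/-∣ʳ)
open import Data.Nat.Divisibility using (divides-refl)
open import Data.Nat.Tactic.RingSolver using (solve-∀)
open import Data.Fin using (toℕ) renaming (zero to f0; suc to fs)
open import Data.Vec using (Vec; []; _∷_; _∷ʳ_; initLast)
open import Data.Vec.Properties using (init-∷ʳ; last-∷ʳ; map-∷ʳ; map-∘; map-cong; map-id)
open import Function using (_∘_)
open import Data.Product using (_×_; _,_)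
open import Relation.Binary.PropositionalEquality using (_≡_; refl; sym; trans; cong; subst; cong₂; module ≡-Reasoning)

[m*2]%2≡0 : ∀ m → m * 2 % 2 ≡ 0
[m*2]%2≡0 m = m*n%n≡0 m 2

[m*2]/2≡m : ∀ m → m * 2 / 2 ≡ m
[m*2]/2≡m m = m*n/n≡m m 2

[1+m*2]%2≡1 : ∀ m → (1 + m * 2) % 2 ≡ 1
[1+m*2]%2≡1 m = [m+kn]%n≡m%n 1 m 2

[1+m*2]/2≡m : ∀ m → (1 + m * 2) / 2 ≡ m
[1+m*2]/2≡m m = trans (+-distrib-/-∣ʳ 1 {d = 2} (divides-refl m)) (m*n/n≡m m 2)

ĥ-even : ∀ k m → ĥ (suc k) (m * 2) ≡ ĥ k m
ĥ-even k m rewrite [m*2]%2≡0 m | [m*2]/2≡m m = refl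

ĥ-odd : ∀ k m → ĥ (suc k) (1 + m * 2) ≡ ĥ k m + ĥ k (suc m)
ĥ-odd k m rewrite [1+m*2]%2≡1 m | [1+m*2]/2≡m m = refl

r̂-even : ∀ k m → r̂ (suc k) (m * 2) ≡ r̂ k m
r̂-even k m rewrite [m*2]%2≡0 m | [m*2]/2≡m m = refl

r̂-odd : ∀ k m → r̂ (suc k) (1 + m * 2) ≡ r̂ k m + r̂ k (suc m)
r̂-odd k m rewrite [1+m*2]%2≡1 m | [1+m*2]/2≡m m = refl

∷ʳ-elim : ∀ {a p} {A : Set a} {n} (P : Vec A (suc n) → Set p) →
          (∀ xs x → P (xs ∷ʳ x)) → ∀ xs → P xs
∷ʳ-elim P P-∷ʳ xs with initLast xs
... | ys , y , eq = subst P (sym eq) (P-∷ʳ ys y)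

flip2-involutive : ∀ b → flip2 (flip2 b) ≡ b
flip2-involutive f0 = refl
flip2-involutive (fs f0) = refl

1-involutive : ∀ {k} (σ : 𝔾 k) → 1- (1- σ) ≡ σ
1-involutive σ = trans (sym (map-∘ flip2 flip2 σ)) (trans (map-cong flip2-involutive σ) (map-id σ))

value-∷ʳ : ∀ {k} (σ : 𝔾 k) b → value (σ ∷ʳ b) ≡ toℕ b + value σ * 2
value-∷ʳ [] b = cong (_+ 0) (*-identityʳ (toℕ b))
value-∷ʳ {suc k} (c ∷ σ) b rewrite value-∷ʳ σ b = lemma (toℕ c) (2 ^ k) (value σ) (toℕ b)
  where
  lemma : ∀ c p v b → c * (2 * p) + (b + v * 2) ≡ b + (c * p + v) * 2
  lemma = solve-∀

value-1-∷ʳ : ∀ {k} (σ : 𝔾 k) b → value (1- (σ ∷ʳ b)) ≡ toℕ (flip2 b) + value (1- σ) * 2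
value-1-∷ʳ σ b = trans (cong value (map-∷ʳ flip2 b σ)) (value-∷ʳ (1- σ) (flip2 b))

ξ-∷ʳ-0 : ∀ s0 s1 k (σ : 𝔾 (suc k)) → ξ s0 s1 (suc k) (σ ∷ʳ f0) ≡ ξ s0 s1 k σ
ξ-∷ʳ-0 s0 s1 k σ rewrite init-∷ʳ f0 σ | last-∷ʳ f0 σ = +-identityʳ _

ξ-∷ʳ-1 : ∀ s0 s1 k (σ : 𝔾 (suc k)) →
         ξ s0 s1 (suc k) (σ ∷ʳ fs f0) ≡ ξ s0 s1 k σ + ξ s0 s1 k (1- σ)
ξ-∷ʳ-1 s0 s1 k σ rewrite init-∷ʳ (fs f0) σ | last-∷ʳ (fs f0) σ =
  cong (ξ s0 s1 k σ +_) (+-identityʳ _)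

module SternRecurrence
  (g : ℕ → ℕ → ℕ) {s0 s1 : ℕ} (g-0 : g 0 0 ≡ s0) (g-1 : g 0 1 ≡ s1)
  (g-even : ∀ k m → g (suc k) (m * 2) ≡ g k m)
  (g-odd : ∀ k m → g (suc k) (1 + m * 2) ≡ g k m + g k (suc m))
  where

  ξ-0∷ : ∀ k (τ : 𝔾 k) → ξ s0 s1 k (f0 ∷ τ) ≡ g k (value τ)
  ξ-1∷ : ∀ k (τ : 𝔾 k) → ξ s0 s1 k (fs f0 ∷ τ) ≡ g k (suc (value (1- τ)))
  ξ-0∷-∷ʳ : ∀ k (τ : 𝔾 k) b → ξ s0 s1 (suc k) ((f0 ∷ τ) ∷ʳ b) ≡ g (suc k) (value (τ ∷ʳ b))
  ξ-1∷-∷ʳ : ∀ k (τ : 𝔾 k) b →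
            ξ s0 s1 (suc k) ((fs f0 ∷ τ) ∷ʳ b) ≡ g (suc k) (suc (value (1- (τ ∷ʳ b))))

  ξ-0∷ zero [] = sym g-0
  ξ-0∷ (suc k) = ∷ʳ-elim (λ τ → ξ s0 s1 (suc k) (f0 ∷ τ) ≡ g (suc k) (value τ)) (ξ-0∷-∷ʳ k)

  ξ-1∷ zero [] = sym g-1
  ξ-1∷ (suc k) = ∷ʳ-elim (λ τ → ξ s0 s1 (suc k) (fs f0 ∷ τ) ≡ g (suc k) (suc (value (1- τ)))) (ξ-1∷-∷ʳ k)

  ξ-0∷-∷ʳ k τ f0 = begin
    ξ s0 s1 (suc k) ((f0 ∷ τ) ∷ʳ f0)  ≡⟨ ξ-∷ʳ-0 s0 s1 k (f0 ∷ τ) ⟩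
    ξ s0 s1 k (f0 ∷ τ)                ≡⟨ ξ-0∷ k τ ⟩
    g k (value τ)                     ≡⟨ g-even k (value τ) ⟨
    g (suc k) (value τ * 2)           ≡⟨ cong (g (suc k)) (value-∷ʳ τ f0) ⟨
    g (suc k) (value (τ ∷ʳ f0))       ∎
    where open ≡-Reasoning
  ξ-0∷-∷ʳ k τ (fs f0) = begin
    ξ s0 s1 (suc k) ((f0 ∷ τ) ∷ʳ fs f0)                ≡⟨ ξ-∷ʳ-1 s0 s1 k (f0 ∷ τ) ⟩
    ξ s0 s1 k (f0 ∷ τ) + ξ s0 s1 k (fs f0 ∷ 1- τ)      ≡⟨ cong₂ _+_ (ξ-0∷ k τ) (ξ-1∷ k (1- τ)) ⟩
    g k (value τ) + g k (suc (value (1- (1- τ))))      ≡⟨ cong (λ σ → g k (value τ) + g k (suc (value σ))) (1-involutive τ) ⟩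
    g k (value τ) + g k (suc (value τ))                ≡⟨ g-odd k (value τ) ⟨
    g (suc k) (1 + value τ * 2)                        ≡⟨ cong (g (suc k)) (value-∷ʳ τ (fs f0)) ⟨
    g (suc k) (value (τ ∷ʳ fs f0))                     ∎
    where open ≡-Reasoning

  ξ-1∷-∷ʳ k τ f0 = begin
    ξ s0 s1 (suc k) ((fs f0 ∷ τ) ∷ʳ f0)    ≡⟨ ξ-∷ʳ-0 s0 s1 k (fs f0 ∷ τ) ⟩
    ξ s0 s1 k (fs f0 ∷ τ)                  ≡⟨ ξ-1∷ k τ ⟩
    g k (suc (value (1- τ)))               ≡⟨ g-even k (suc (value (1- τ))) ⟨
    g (suc k) (suc (1 + value (1- τ) * 2)) ≡⟨ cong (g (suc k) ∘ suc) (value-1-∷ʳ τ f0) ⟨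
    g (suc k) (suc (value (1- (τ ∷ʳ f0)))) ∎
    where open ≡-Reasoning
  ξ-1∷-∷ʳ k τ (fs f0) = begin
    ξ s0 s1 (suc k) ((fs f0 ∷ τ) ∷ʳ fs f0)          ≡⟨ ξ-∷ʳ-1 s0 s1 k (fs f0 ∷ τ) ⟩
    ξ s0 s1 k (fs f0 ∷ τ) + ξ s0 s1 k (f0 ∷ 1- τ)   ≡⟨ cong₂ _+_ (ξ-1∷ k τ) (ξ-0∷ k (1- τ)) ⟩
    g k (suc (value (1- τ))) + g k (value (1- τ))   ≡⟨ +-comm _ (g k (value (1- τ))) ⟩
    g k (value (1- τ)) + g k (suc (value (1- τ)))   ≡⟨ g-odd k (value (1- τ)) ⟨
    g (suc k) (1 + value (1- τ) * 2)                ≡⟨ cong (g (suc k) ∘ suc) (value-1-∷ʳ τ (fs f0)) ⟨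
    g (suc k) (suc (value (1- (τ ∷ʳ fs f0))))       ∎
    where open ≡-Reasoning

corollary2p2 : (k a : ℕ) → a < 2 ^ k → (σ : 𝔾 k) → value σ ≡ a →
    (ĥ k a ≡ h k σ) × (r̂ k a ≡ r k σ)
-- The bound a < 2^k is automatic for a = value σ and is not needed.
corollary2p2 k _ _ σ refl =
  sym (SternRecurrence.ξ-0∷ ĥ refl refl ĥ-even ĥ-odd k σ) ,
  sym (SternRecurrence.ξ-0∷ r̂ refl refl r̂-even r̂-odd k σ)
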